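{- For every integer $m$ and every positive integer $n$, \[ \sum_{j=1}^n\binom{n}{j}\Big\lfloor\frac{j}{2}\Big\rfloor 2^jF_{j+m}= \begin{cases} nF_{3n+m-2}-\frac14F_{3n+m}+\frac{5^{n/2}}{4}F_m, & n\text{ even};\\[4pt] nF_{3n+m-2}-\frac14F_{3n+m}-\frac{5^{(n-1)/2}}{4}L_m, & n\text{ odd}, \end{cases} \] and \[ \sum_{j=1}^n\binom{n}{j}\Big\lfloor\frac{j}{2}\Big\rfloor 2^jL_{j+m}= \begin{cases} nL_{3n+m-2}-\frac14L_{3n+m}+\frac{5^{n/2}}{4}L_m, & n\text{ even};\\[4pt] nL_{3n+m-2}-\frac14L_{3n+m}-\frac{5^{(n+1)/2}}{4}F_m, & n\text{ odd}. \end{cases} \]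
   Context: $F_n$ and $L_n$ are the Fibonacci and Lucas numbers, defined for all integers $n$ by $F_n=(\alpha^n-\beta^n)/\sqrt5$, $L_n=\alpha^n+\beta^n$ with $\alpha=(1+\sqrt5)/2$, $\beta=(1-\sqrt5)/2$. $\lfloor x\rfloor$ is the floor function. -}

module Defs where

open import Data.Nat as ℕ using (ℕ; zero; suc)
open import Data.Integer as ℤ using (ℤ; +_; -[1+_]; _+_; _*_; -_)

fibℕ : ℕ → ℕ
fibℕ zero = 0
fibℕ (suc zero) = 1
fibℕ (suc (suc n)) = fibℕ (suc n) ℕ.+ fibℕ n

lucℕ : ℕ → ℕ
lucℕ zero = 2
lucℕ (suc zero) = 1
lucℕ (suc (suc n)) = lucℕ (suc n) ℕ.+ lucℕ n

sgn : ℕ → ℤ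
sgn zero = + 1
sgn (suc k) = - sgn k

-- Extension to all integers, agreeing with the Binet formulas:
-- F_{-n} = (-1)^{n+1} F_n,  L_{-n} = (-1)^n L_n.
F : ℤ → ℤ
F (+ n) = + fibℕ n
F -[1+ k ] = sgn k * + fibℕ (suc k)

L : ℤ → ℤ
L (+ n) = + lucℕ n
L -[1+ k ] = sgn (suc k) * + lucℕ (suc k)

sum1to : ℕ → (ℕ → ℤ) → ℤ
sum1to zero f = + 0
sum1to (suc n) f = sum1to n f + f (suc n)

{-# OPTIONS --safe #-}
-- Since 4⌊j/2⌋ = 2j − 1 + (−1)^j, the sum splits into three binomial sums
-- Σ C(n,j) x^j G_j (one weighted by j) with x = ±2 and G_j = F_{j+m} or L_{j+m}.
-- For a Fibonacci-like G such a sum is ((1 + xE)^n G)_0, E being the shift.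
-- As 1 + 2α = α³ and 1 + 2β = β³, the operator 1 + 2E acts as E³, giving G_{3n};
-- as (1 − 2α)² = (1 − 2β)² = 5, (1 − 2E)² acts as multiplication by 5, giving
-- 5^{n/2} G_0 or 5^{(n−1)/2} (G_0 − 2G_1) according to parity.  The weighted sum
-- reduces to an unweighted one by absorption, j C(n,j) = n C(n−1,j−1).  Finally
-- L_m = 2F_{m+1} − F_m and 5F_m = 2L_{m+1} − L_m on all of ℤ, since both sides
-- satisfy the Fibonacci recurrence and agree at 0 and 1.
module Submission where

open import Defs
open import Data.Nat as ℕ using (ℕ; zero; suc; _/_; _^_; _%_)
import Data.Nat.Properties as ℕₚ
open import Data.Nat.DivMod using (m≡m%n+[m/n]*n; m*n/n≡m; m/n≡1+[m∸n]/n)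
open import Data.Nat.Combinatorics using (_C_; nC1≡n; nCk+nC[k+1]≡[n+1]C[k+1])
open import Data.Nat.Combinatorics.Specification using (k>n⇒nCk≡0)
import Data.Nat.Tactic.RingSolver as ℕ-Solver
open import Data.Integer as ℤ using (ℤ; +_; -[1+_]; _+_; _-_; _*_; -_)
open import Data.Integer.Properties
  using ( +-assoc; +-identityˡ; +-identityʳ; *-identityˡ; *-assoc; *-distribˡ-+; *-distribʳ-+
        ; pos-*; pos-+; +-0-abelianGroup)
open import Data.Integer.Tactic.RingSolver using (solve-∀)
open import Algebra.Properties.AbelianGroup +-0-abelianGroup using (∙-cancelˡ)
open import Data.Product using (_×_; _,_; proj₁)
open import Relation.Binary.PropositionalEquality
open ≡-Reasoning

-- Two-sided sequences satisfying the Fibonacci recurrence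

record FibonacciRecurrence (A : ℤ → ℤ) : Set where
  constructor recurrence
  field step : ∀ k → A (+ 2 + k) ≡ A (+ 1 + k) + A k

open FibonacciRecurrence

F-recurrence : FibonacciRecurrence F
F-recurrence = recurrence F-step
  where
  negative : ∀ s a b → s * a ≡ - s * b + - - s * (b + a)
  negative = solve-∀
  F-step : ∀ k → F (+ 2 + k) ≡ F (+ 1 + k) + F k
  F-step (+ n) = refl
  F-step -[1+ 0 ] = refl
  F-step -[1+ 1 ] = refl
  F-step -[1+ suc (suc i) ] = negative (sgn i) (+ fibℕ (suc i)) (+ fibℕ (suc (suc i)))

L-recurrence : FibonacciRecurrence L
L-recurrence = recurrence L-step
  where
  negative : ∀ s a b → - s * a ≡ - - s * b + - - - s * (b + a)
  negative = solve-∀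
  L-step : ∀ k → L (+ 2 + k) ≡ L (+ 1 + k) + L k
  L-step (+ n) = refl
  L-step -[1+ 0 ] = refl
  L-step -[1+ 1 ] = refl
  L-step -[1+ suc (suc i) ] = negative (sgn i) (+ lucℕ (suc i)) (+ lucℕ (suc (suc i)))

ℤ-bi-induction : (P : ℤ → Set) → P (+ 0) →
  (∀ k → P k → P (+ 1 + k)) → (∀ k → P (+ 1 + k) → P k) → ∀ k → P k
ℤ-bi-induction P p₀ up down = go
  where
  go : ∀ k → P k
  go (+ zero) = p₀
  go (+ suc n) = up (+ n) (go (+ n))
  go -[1+ zero ] = down -[1+ 0 ] p₀
  go -[1+ suc n ] = down -[1+ suc n ] (go -[1+ n ])

recurrence-unique : ∀ {A B} → FibonacciRecurrence A → FibonacciRecurrence B →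
  A (+ 0) ≡ B (+ 0) → A (+ 1) ≡ B (+ 1) → ∀ k → A k ≡ B k
recurrence-unique {A} {B} recA recB e₀ e₁ k = proj₁ (ℤ-bi-induction P (e₀ , e₁) up down k)
  where
  P : ℤ → Set
  P k = A k ≡ B k × A (+ 1 + k) ≡ B (+ 1 + k)
  1+[1+k]≡2+k : ∀ k → + 1 + (+ 1 + k) ≡ + 2 + k
  1+[1+k]≡2+k k = sym (+-assoc (+ 1) (+ 1) k)
  up : ∀ k → P k → P (+ 1 + k)
  up k (a , b) = b , (begin
    A (+ 1 + (+ 1 + k))  ≡⟨ cong A (1+[1+k]≡2+k k) ⟩
    A (+ 2 + k)          ≡⟨ step recA k ⟩
    A (+ 1 + k) + A k    ≡⟨ cong₂ _+_ b a ⟩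
    B (+ 1 + k) + B k    ≡⟨ step recB k ⟨
    B (+ 2 + k)          ≡⟨ cong B (1+[1+k]≡2+k k) ⟨
    B (+ 1 + (+ 1 + k))  ∎)
  down : ∀ k → P (+ 1 + k) → P k
  down k (b , c) = ∙-cancelˡ (A (+ 1 + k)) (A k) (B k) (begin
    A (+ 1 + k) + A k    ≡⟨ step recA k ⟨
    A (+ 2 + k)          ≡⟨ cong A (1+[1+k]≡2+k k) ⟨
    A (+ 1 + (+ 1 + k))  ≡⟨ c ⟩
    B (+ 1 + (+ 1 + k))  ≡⟨ cong B (1+[1+k]≡2+k k) ⟩
    B (+ 2 + k)          ≡⟨ step recB k ⟩
    B (+ 1 + k) + B k    ≡⟨ cong (_+ B k) b ⟨
    A (+ 1 + k) + B k    ∎) , b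

recurrence-shift : ∀ {A} → FibonacciRecurrence A → FibonacciRecurrence (λ k → A (+ 1 + k))
recurrence-shift {A} recA = recurrence λ k →
  trans (cong A (trans (sym (+-assoc (+ 1) (+ 2) k)) (+-assoc (+ 2) (+ 1) k))) (step recA (+ 1 + k))

recurrence-scale : ∀ c {A} → FibonacciRecurrence A → FibonacciRecurrence (λ k → c * A k)
recurrence-scale c {A} recA = recurrence λ k →
  trans (cong (c *_) (step recA k)) (distrib c (A (+ 1 + k)) (A k))
  where
  distrib : ∀ c a b → c * (a + b) ≡ c * a + c * b
  distrib = solve-∀

recurrence-sub : ∀ {A B} → FibonacciRecurrence A → FibonacciRecurrence B →
  FibonacciRecurrence (λ k → A k - B k)
recurrence-sub {A} {B} recA recB = recurrence λ k →
  trans (cong₂ _-_ (step recA k) (step recB k)) (regroup (A (+ 1 + k)) (A k) (B (+ 1 + k)) (B k))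
  where
  regroup : ∀ a b c d → (a + b) - (c + d) ≡ (a - c) + (b - d)
  regroup = solve-∀

L≡2F[1+k]-F : ∀ k → L k ≡ + 2 * F (+ 1 + k) - F k
L≡2F[1+k]-F = recurrence-unique L-recurrence 2F[1+k]-F-recurrence refl refl
  where
  2F[1+k]-F-recurrence : FibonacciRecurrence (λ k → + 2 * F (+ 1 + k) - F k)
  2F[1+k]-F-recurrence = recurrence-sub (recurrence-scale (+ 2) (recurrence-shift F-recurrence)) F-recurrence

5F≡2L[1+k]-L : ∀ k → + 5 * F k ≡ + 2 * L (+ 1 + k) - L k
5F≡2L[1+k]-L = recurrence-unique (recurrence-scale (+ 5) F-recurrence) 2L[1+k]-L-recurrence refl refl
  where
  2L[1+k]-L-recurrence : FibonacciRecurrence (λ k → + 2 * L (+ 1 + k) - L k)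
  2L[1+k]-L-recurrence = recurrence-sub (recurrence-scale (+ 2) (recurrence-shift L-recurrence)) L-recurrence

IsFibonacciLike : (ℕ → ℤ) → Set
IsFibonacciLike G = ∀ j → G (2 ℕ.+ j) ≡ G (1 ℕ.+ j) + G j

recurrence⇒fibonacciLike : ∀ {A} → FibonacciRecurrence A → ∀ m → IsFibonacciLike (λ j → A (+ j + m))
recurrence⇒fibonacciLike {A} recA m j = begin
  A (+ (2 ℕ.+ j) + m)                ≡⟨ cong A (+-assoc (+ 2) (+ j) m) ⟩
  A (+ 2 + (+ j + m))                ≡⟨ step recA (+ j + m) ⟩
  A (+ 1 + (+ j + m)) + A (+ j + m)  ≡⟨ cong (λ i → A i + A (+ j + m)) (+-assoc (+ 1) (+ j) m) ⟨
  A (+ (1 ℕ.+ j) + m) + A (+ j + m)  ∎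

-- The operator 1 + xE on Fibonacci-like sequences

⟨1+_E⟩ : ℤ → (ℕ → ℤ) → ℕ → ℤ
⟨1+ x E⟩ G j = G j + x * G (suc j)

⟨1+_E⟩^[_] : ℤ → ℕ → (ℕ → ℤ) → ℕ → ℤ
⟨1+ x E⟩^[ zero ] G = G
⟨1+ x E⟩^[ suc n ] G = ⟨1+ x E⟩^[ n ] (⟨1+ x E⟩ G)

⟨1+E⟩-fibonacciLike : ∀ x G → IsFibonacciLike G → IsFibonacciLike (⟨1+ x E⟩ G)
⟨1+E⟩-fibonacciLike x G fibG j =
  trans (cong₂ (λ a b → a + x * b) (fibG j) (fibG (suc j))) (regroup x (G j) (G (1 ℕ.+ j)) (G (2 ℕ.+ j)))
  where
  regroup : ∀ x a b c → b + a + x * (c + b) ≡ (b + x * c) + (a + x * b)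
  regroup = solve-∀

⟨1+E⟩^-cong : ∀ x n {G H} → (∀ j → G j ≡ H j) → ∀ j → ⟨1+ x E⟩^[ n ] G j ≡ ⟨1+ x E⟩^[ n ] H j
⟨1+E⟩^-cong x zero G≡H = G≡H
⟨1+E⟩^-cong x (suc n) G≡H = ⟨1+E⟩^-cong x n (λ j → cong₂ (λ a b → a + x * b) (G≡H j) (G≡H (suc j)))

⟨1+E⟩^-scale : ∀ x n c (G : ℕ → ℤ) j → ⟨1+ x E⟩^[ n ] (λ i → c * G i) j ≡ c * ⟨1+ x E⟩^[ n ] G j
⟨1+E⟩^-scale x zero c G j = refl
⟨1+E⟩^-scale x (suc n) c G j =
  trans (⟨1+E⟩^-cong x n (λ i → distrib x c (G i) (G (suc i))) j) (⟨1+E⟩^-scale x n c (⟨1+ x E⟩ G) j)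
  where
  distrib : ∀ x c a b → c * a + x * (c * b) ≡ c * (a + x * b)
  distrib = solve-∀

⟨1+2E⟩-fibonacciLike : ∀ G → IsFibonacciLike G → ∀ j → ⟨1+ + 2 E⟩ G j ≡ G (3 ℕ.+ j)
⟨1+2E⟩-fibonacciLike G fibG j = sym (begin
  G (3 ℕ.+ j)                      ≡⟨ fibG (suc j) ⟩
  G (2 ℕ.+ j) + G (1 ℕ.+ j)        ≡⟨ cong (_+ G (1 ℕ.+ j)) (fibG j) ⟩
  G (1 ℕ.+ j) + G j + G (1 ℕ.+ j)  ≡⟨ regroup (G j) (G (1 ℕ.+ j)) ⟩
  G j + + 2 * G (suc j)            ∎)
  where
  regroup : ∀ a b → b + a + b ≡ a + + 2 * b
  regroup = solve-∀

⟨1+2E⟩^-fibonacciLike : ∀ n G → IsFibonacciLike G → ∀ j → ⟨1+ + 2 E⟩^[ n ] G j ≡ G (n ℕ.* 3 ℕ.+ j)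
⟨1+2E⟩^-fibonacciLike zero G fibG j = refl
⟨1+2E⟩^-fibonacciLike (suc n) G fibG j =
  trans (⟨1+2E⟩^-fibonacciLike n (⟨1+ + 2 E⟩ G) (⟨1+E⟩-fibonacciLike (+ 2) G fibG) j)
        (⟨1+2E⟩-fibonacciLike G fibG (n ℕ.* 3 ℕ.+ j))

⟨1-2E⟩²-fibonacciLike : ∀ G → IsFibonacciLike G → ∀ j → ⟨1+ - + 2 E⟩ (⟨1+ - + 2 E⟩ G) j ≡ + 5 * G j
⟨1-2E⟩²-fibonacciLike G fibG j =
  trans (cong (λ c → G j + - + 2 * G (1 ℕ.+ j) + - + 2 * (G (1 ℕ.+ j) + - + 2 * c)) (fibG j))
        (collapse (G j) (G (1 ℕ.+ j)))
  where
  collapse : ∀ a b → a + - + 2 * b + - + 2 * (b + - + 2 * (b + a)) ≡ + 5 * a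
  collapse = solve-∀

⟨1-2E⟩^[2h]-fibonacciLike : ∀ h G → IsFibonacciLike G → ∀ j → ⟨1+ - + 2 E⟩^[ h ℕ.* 2 ] G j ≡ + (5 ^ h) * G j
⟨1-2E⟩^[2h]-fibonacciLike zero G fibG j = sym (*-identityˡ (G j))
⟨1-2E⟩^[2h]-fibonacciLike (suc h) G fibG j = begin
  ⟨1+ - + 2 E⟩^[ h ℕ.* 2 ] (⟨1+ - + 2 E⟩ (⟨1+ - + 2 E⟩ G)) j
    ≡⟨ ⟨1+E⟩^-cong (- + 2) (h ℕ.* 2) (⟨1-2E⟩²-fibonacciLike G fibG) j ⟩
  ⟨1+ - + 2 E⟩^[ h ℕ.* 2 ] (λ i → + 5 * G i) j
    ≡⟨ ⟨1+E⟩^-scale (- + 2) (h ℕ.* 2) (+ 5) G j ⟩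
  + 5 * ⟨1+ - + 2 E⟩^[ h ℕ.* 2 ] G j
    ≡⟨ cong (+ 5 *_) (⟨1-2E⟩^[2h]-fibonacciLike h G fibG j) ⟩
  + 5 * (+ (5 ^ h) * G j)
    ≡⟨ *-assoc (+ 5) (+ (5 ^ h)) (G j) ⟨
  + 5 * + (5 ^ h) * G j
    ≡⟨ cong (_* G j) (pos-* 5 (5 ^ h)) ⟨
  + (5 ^ suc h) * G j
    ∎

-- Binomial sums

sum0to : ℕ → (ℕ → ℤ) → ℤ
sum0to zero f = f 0
sum0to (suc n) f = f 0 + sum0to n (λ j → f (suc j))

sum0to-cong : ∀ n {f g : ℕ → ℤ} → (∀ j → f j ≡ g j) → sum0to n f ≡ sum0to n g
sum0to-cong zero f≡g = f≡g 0
sum0to-cong (suc n) f≡g = cong₂ _+_ (f≡g 0) (sum0to-cong n (λ j → f≡g (suc j)))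

sum0to-+ : ∀ n (f g : ℕ → ℤ) → sum0to n (λ j → f j + g j) ≡ sum0to n f + sum0to n g
sum0to-+ zero f g = refl
sum0to-+ (suc n) f g = trans (cong (_+_ (f 0 + g 0)) (sum0to-+ n _ _))
  (interchange (f 0) (g 0) (sum0to n (λ j → f (suc j))) (sum0to n (λ j → g (suc j))))
  where
  interchange : ∀ a b c d → a + b + (c + d) ≡ a + c + (b + d)
  interchange = solve-∀

sum0to-*ˡ : ∀ n c (f : ℕ → ℤ) → sum0to n (λ j → c * f j) ≡ c * sum0to n f
sum0to-*ˡ zero c f = refl
sum0to-*ˡ (suc n) c f = trans (cong (_+_ (c * f 0)) (sum0to-*ˡ n c _)) (sym (*-distribˡ-+ c (f 0) _))

sum0to-snoc : ∀ n (f : ℕ → ℤ) → sum0to (suc n) f ≡ sum0to n f + f (suc n)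
sum0to-snoc zero f = refl
sum0to-snoc (suc n) f =
  trans (cong (_+_ (f 0)) (sum0to-snoc n (λ j → f (suc j)))) (sym (+-assoc (f 0) _ _))

sum0to≡f0+sum1to : ∀ n (f : ℕ → ℤ) → sum0to n f ≡ f 0 + sum1to n f
sum0to≡f0+sum1to zero f = sym (+-identityʳ (f 0))
sum0to≡f0+sum1to (suc n) f =
  trans (sum0to-snoc n f) (trans (cong (_+ f (suc n)) (sum0to≡f0+sum1to n f)) (+-assoc (f 0) _ _))

sum0to-pascal : ∀ n (u : ℕ → ℤ) →
  sum0to (suc n) (λ j → + (suc n C j) * u j) ≡ sum0to n (λ j → + (n C j) * (u j + u (suc j)))
sum0to-pascal n u = begin
  + 1 * u 0 + sum0to n c
    ≡⟨ cong (_+_ (+ 1 * u 0)) (trans (sum0to-cong n pascal) (sum0to-+ n a b)) ⟩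
  + 1 * u 0 + (sum0to n a + sum0to n b)
    ≡⟨ regroup (+ 1 * u 0) (sum0to n a) (sum0to n b) ⟩
  -- the j = 0 term and the C(n, j+1) half form the sum up to n+1, whose last term vanishes
  sum0to (suc n) h + sum0to n a
    ≡⟨ cong (_+ sum0to n a) (sum0to-snoc n h) ⟩
  sum0to n h + h (suc n) + sum0to n a
    ≡⟨ cong (λ m → sum0to n h + + m * u (suc n) + sum0to n a) (k>n⇒nCk≡0 (ℕₚ.n<1+n n)) ⟩
  sum0to n h + + 0 + sum0to n a
    ≡⟨ cong (_+ sum0to n a) (+-identityʳ (sum0to n h)) ⟩
  sum0to n h + sum0to n a
    ≡⟨ sum0to-+ n h a ⟨
  sum0to n (λ j → h j + a j)
    ≡⟨ sum0to-cong n (λ j → *-distribˡ-+ (+ (n C j)) (u j) (u (suc j))) ⟨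
  sum0to n (λ j → + (n C j) * (u j + u (suc j)))
    ∎
  where
  c h a b : ℕ → ℤ
  c j = + (suc n C suc j) * u (suc j)
  h j = + (n C j) * u j
  a j = + (n C j) * u (suc j)
  b j = + (n C suc j) * u (suc j)
  pascal : ∀ j → c j ≡ a j + b j
  pascal j = trans (cong (λ m → + m * u (suc j)) (sym (nCk+nC[k+1]≡[n+1]C[k+1] n j)))
                   (trans (cong (_* u (suc j)) (sym (pos-+ (n C j) (n C suc j))))
                          (*-distribʳ-+ (u (suc j)) (+ (n C j)) (+ (n C suc j))))
  regroup : ∀ x p q → x + (p + q) ≡ x + q + p
  regroup = solve-∀

[k+1]*[n+1]C[k+1]≡[n+1]*nCk : ∀ n k → suc k ℕ.* (suc n C suc k) ≡ suc n ℕ.* (n C k)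
[k+1]*[n+1]C[k+1]≡[n+1]*nCk zero zero = refl
[k+1]*[n+1]C[k+1]≡[n+1]*nCk zero (suc k) = ℕₚ.*-zeroʳ (suc (suc k))
[k+1]*[n+1]C[k+1]≡[n+1]*nCk (suc n) zero =
  trans (ℕₚ.*-identityˡ _) (trans (nC1≡n (suc (suc n))) (sym (ℕₚ.*-identityʳ (suc (suc n)))))
[k+1]*[n+1]C[k+1]≡[n+1]*nCk (suc n) (suc k) = begin
  suc (suc k) ℕ.* (suc (suc n) C suc (suc k))
    ≡⟨ cong (suc (suc k) ℕ.*_) (nCk+nC[k+1]≡[n+1]C[k+1] (suc n) (suc k)) ⟨
  suc (suc k) ℕ.* (c ℕ.+ d)
    ≡⟨ regroup c d k ⟩
  c ℕ.+ suc k ℕ.* c ℕ.+ suc (suc k) ℕ.* d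
    ≡⟨ cong₂ (λ p q → c ℕ.+ p ℕ.+ q) ([k+1]*[n+1]C[k+1]≡[n+1]*nCk n k) ([k+1]*[n+1]C[k+1]≡[n+1]*nCk n (suc k)) ⟩
  c ℕ.+ suc n ℕ.* (n C k) ℕ.+ suc n ℕ.* (n C suc k)
    ≡⟨ factor c (suc n) (n C k) (n C suc k) ⟩
  c ℕ.+ suc n ℕ.* (n C k ℕ.+ n C suc k)
    ≡⟨ cong (λ p → c ℕ.+ suc n ℕ.* p) (nCk+nC[k+1]≡[n+1]C[k+1] n k) ⟩
  suc (suc n) ℕ.* c
    ∎
  where
  c d : ℕ
  c = suc n C suc k
  d = suc n C suc (suc k)
  regroup : ∀ c d k → (2 ℕ.+ k) ℕ.* (c ℕ.+ d) ≡ c ℕ.+ (1 ℕ.+ k) ℕ.* c ℕ.+ (2 ℕ.+ k) ℕ.* d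
  regroup = ℕ-Solver.solve-∀
  factor : ∀ c m a b → c ℕ.+ m ℕ.* a ℕ.+ m ℕ.* b ≡ c ℕ.+ m ℕ.* (a ℕ.+ b)
  factor = ℕ-Solver.solve-∀

binomial-transform : ∀ x n (G : ℕ → ℤ) → sum0to n (λ j → + (n C j) * (x ℤ.^ j * G j)) ≡ ⟨1+ x E⟩^[ n ] G 0
binomial-transform x zero G = trans (*-identityˡ _) (*-identityˡ (G 0))
binomial-transform x (suc n) G = begin
  sum0to (suc n) (λ j → + (suc n C j) * (x ℤ.^ j * G j))
    ≡⟨ sum0to-pascal n (λ j → x ℤ.^ j * G j) ⟩
  sum0to n (λ j → + (n C j) * (x ℤ.^ j * G j + x ℤ.^ suc j * G (suc j)))
    ≡⟨ sum0to-cong n (λ j → cong (+ (n C j) *_) (factor x (x ℤ.^ j) (G j) (G (suc j)))) ⟩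
  sum0to n (λ j → + (n C j) * (x ℤ.^ j * ⟨1+ x E⟩ G j))
    ≡⟨ binomial-transform x n (⟨1+ x E⟩ G) ⟩
  ⟨1+ x E⟩^[ suc n ] G 0
    ∎
  where
  factor : ∀ x p a b → p * a + x * p * b ≡ p * (a + x * b)
  factor = solve-∀

weighted-binomial-transform : ∀ x n (G : ℕ → ℤ) →
  sum0to (suc n) (λ j → + (suc n C j) * (+ j * (x ℤ.^ j * G j)))
    ≡ + suc n * (x * ⟨1+ x E⟩^[ n ] (λ j → G (suc j)) 0)
weighted-binomial-transform x n G = begin
  + 0 + sum0to n (λ j → + (suc n C suc j) * (+ suc j * (x ℤ.^ suc j * G (suc j))))
    ≡⟨ +-identityˡ _ ⟩
  sum0to n (λ j → + (suc n C suc j) * (+ suc j * (x ℤ.^ suc j * G (suc j))))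
    ≡⟨ sum0to-cong n absorb ⟩
  sum0to n (λ j → + suc n * (x * (+ (n C j) * (x ℤ.^ j * G (suc j)))))
    ≡⟨ sum0to-*ˡ n (+ suc n) _ ⟩
  + suc n * sum0to n (λ j → x * (+ (n C j) * (x ℤ.^ j * G (suc j))))
    ≡⟨ cong (+ suc n *_) (sum0to-*ˡ n x _) ⟩
  + suc n * (x * sum0to n (λ j → + (n C j) * (x ℤ.^ j * G (suc j))))
    ≡⟨ cong (λ s → + suc n * (x * s)) (binomial-transform x n (λ j → G (suc j))) ⟩
  + suc n * (x * ⟨1+ x E⟩^[ n ] (λ j → G (suc j)) 0)
    ∎
  where
  absorption : ∀ j → + suc j * + (suc n C suc j) ≡ + suc n * + (n C j)
  absorption j = trans (sym (pos-* (suc j) (suc n C suc j)))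
                       (trans (cong +_ ([k+1]*[n+1]C[k+1]≡[n+1]*nCk n j)) (pos-* (suc n) (n C j)))
  regroup : ∀ c k x p g → c * (k * (x * p * g)) ≡ k * c * (x * p * g)
  regroup = solve-∀
  factor : ∀ m c x p g → m * c * (x * p * g) ≡ m * (x * (c * (p * g)))
  factor = solve-∀
  absorb : ∀ j → + (suc n C suc j) * (+ suc j * (x ℤ.^ suc j * G (suc j)))
                 ≡ + suc n * (x * (+ (n C j) * (x ℤ.^ j * G (suc j))))
  absorb j = begin
    + (suc n C suc j) * (+ suc j * (x * x ℤ.^ j * G (suc j)))
      ≡⟨ regroup (+ (suc n C suc j)) (+ suc j) x (x ℤ.^ j) (G (suc j)) ⟩
    + suc j * + (suc n C suc j) * (x * x ℤ.^ j * G (suc j))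
      ≡⟨ cong (_* (x * x ℤ.^ j * G (suc j))) (absorption j) ⟩
    + suc n * + (n C j) * (x * x ℤ.^ j * G (suc j))
      ≡⟨ factor (+ suc n) (+ (n C j)) x (x ℤ.^ j) (G (suc j)) ⟩
    + suc n * (x * (+ (n C j) * (x ℤ.^ j * G (suc j))))
      ∎

4*⌊j/2⌋≡2j-1+[-1]^j : ∀ j → + 4 * + (j / 2) ≡ + 2 * + j - + 1 + sgn j
4*⌊j/2⌋≡2j-1+[-1]^j zero = refl
4*⌊j/2⌋≡2j-1+[-1]^j (suc zero) = refl
4*⌊j/2⌋≡2j-1+[-1]^j (suc (suc j)) = begin
  + 4 * + ((2 ℕ.+ j) / 2)          ≡⟨ cong (λ q → + 4 * + q) (m/n≡1+[m∸n]/n {2 ℕ.+ j} {2} (ℕ.s≤s (ℕ.s≤s ℕ.z≤n))) ⟩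
  + 4 * (+ 1 + + (j / 2))           ≡⟨ *-distribˡ-+ (+ 4) (+ 1) (+ (j / 2)) ⟩
  + 4 + + 4 * + (j / 2)             ≡⟨ cong (_+_ (+ 4)) (4*⌊j/2⌋≡2j-1+[-1]^j j) ⟩
  + 4 + (+ 2 * + j - + 1 + sgn j)   ≡⟨ shift (+ j) (sgn j) ⟩
  + 2 * + (2 ℕ.+ j) - + 1 + - - sgn j  ∎
  where
  shift : ∀ j s → + 4 + (+ 2 * j - + 1 + s) ≡ + 2 * (+ 2 + j) - + 1 + - - s
  shift = solve-∀

pos-^ : ∀ m n → + (m ^ n) ≡ (+ m) ℤ.^ n
pos-^ m zero = refl
pos-^ m (suc n) = trans (pos-* m (m ^ n)) (cong (+ m *_) (pos-^ m n))

[-2]^j≡[-1]^j*2^j : ∀ j → (- + 2) ℤ.^ j ≡ sgn j * (+ 2) ℤ.^ j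
[-2]^j≡[-1]^j*2^j zero = refl
[-2]^j≡[-1]^j*2^j (suc j) = trans (cong (- + 2 *_) ([-2]^j≡[-1]^j*2^j j)) (sign-out (sgn j) ((+ 2) ℤ.^ j))
  where
  sign-out : ∀ s p → - + 2 * (s * p) ≡ - s * (+ 2 * p)
  sign-out = solve-∀

binomialFloorSum : ℕ → (ℕ → ℤ) → ℤ
binomialFloorSum n G = sum1to n (λ j → + (n C j) * + (j / 2) * + (2 ^ j) * G j)

4*binomialFloorSum-fibonacciLike : ∀ k G → IsFibonacciLike G →
  + 4 * binomialFloorSum (suc k) G
    ≡ + 4 * (+ suc k * G (suc (k ℕ.* 3))) - G (suc k ℕ.* 3) + ⟨1+ - + 2 E⟩^[ suc k ] G 0
4*binomialFloorSum-fibonacciLike k G fibG = begin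
  + 4 * sum1to n t
    ≡⟨ cong (+ 4 *_) (trans (sym (+-identityˡ _)) (sym (sum0to≡f0+sum1to n t))) ⟩
  + 4 * sum0to n t
    ≡⟨ sum0to-*ˡ n (+ 4) t ⟨
  sum0to n (λ j → + 4 * t j)
    ≡⟨ sum0to-cong n split ⟩
  sum0to n (λ j → + 2 * w j + - + 1 * b j + c j)
    ≡⟨ sum0to-+ n (λ j → + 2 * w j + - + 1 * b j) c ⟩
  sum0to n (λ j → + 2 * w j + - + 1 * b j) + sum0to n c
    ≡⟨ cong (_+ sum0to n c) (sum0to-+ n (λ j → + 2 * w j) (λ j → - + 1 * b j)) ⟩
  sum0to n (λ j → + 2 * w j) + sum0to n (λ j → - + 1 * b j) + sum0to n c
    ≡⟨ cong₂ (λ p q → p + q + sum0to n c) (sum0to-*ˡ n (+ 2) w) (sum0to-*ˡ n (- + 1) b) ⟩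
  + 2 * sum0to n w + - + 1 * sum0to n b + sum0to n c
    ≡⟨ cong₂ (λ p q → + 2 * p + - + 1 * q + sum0to n c)
         (weighted-binomial-transform (+ 2) k G) (binomial-transform (+ 2) n G) ⟩
  + 2 * (+ n * (+ 2 * ⟨1+ + 2 E⟩^[ k ] G₁ 0)) + - + 1 * ⟨1+ + 2 E⟩^[ n ] G 0 + sum0to n c
    ≡⟨ cong₂ (λ p q → + 2 * (+ n * (+ 2 * p)) + - + 1 * q + sum0to n c)
         (⟨1+2E⟩^-at-0 k G₁ (λ j → fibG (suc j))) (⟨1+2E⟩^-at-0 n G fibG) ⟩
  + 2 * (+ n * (+ 2 * G (suc (k ℕ.* 3)))) + - + 1 * G (n ℕ.* 3) + sum0to n c
    ≡⟨ cong (_+_ (+ 2 * (+ n * (+ 2 * G (suc (k ℕ.* 3)))) + - + 1 * G (n ℕ.* 3)))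
         (binomial-transform (- + 2) n G) ⟩
  + 2 * (+ n * (+ 2 * G (suc (k ℕ.* 3)))) + - + 1 * G (n ℕ.* 3) + ⟨1+ - + 2 E⟩^[ n ] G 0
    ≡⟨ collect (+ n) (G (suc (k ℕ.* 3))) (G (n ℕ.* 3)) (⟨1+ - + 2 E⟩^[ n ] G 0) ⟩
  + 4 * (+ n * G (suc (k ℕ.* 3))) - G (n ℕ.* 3) + ⟨1+ - + 2 E⟩^[ n ] G 0
    ∎
  where
  n : ℕ
  n = suc k
  G₁ t w b c : ℕ → ℤ
  G₁ j = G (suc j)
  t j = + (n C j) * + (j / 2) * + (2 ^ j) * G j
  w j = + (n C j) * (+ j * ((+ 2) ℤ.^ j * G j))
  b j = + (n C j) * ((+ 2) ℤ.^ j * G j)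
  c j = + (n C j) * ((- + 2) ℤ.^ j * G j)
  ⟨1+2E⟩^-at-0 : ∀ i H → IsFibonacciLike H → ⟨1+ + 2 E⟩^[ i ] H 0 ≡ H (i ℕ.* 3)
  ⟨1+2E⟩^-at-0 i H fibH = trans (⟨1+2E⟩^-fibonacciLike i H fibH 0) (cong H (ℕₚ.+-identityʳ (i ℕ.* 3)))
  pull : ∀ C Q P g → + 4 * (C * Q * P * g) ≡ C * (+ 4 * Q) * P * g
  pull = solve-∀
  expand : ∀ C J S P g → C * (+ 2 * J - + 1 + S) * P * g
                           ≡ + 2 * (C * (J * (P * g))) + - + 1 * (C * (P * g)) + C * (S * P * g)
  expand = solve-∀
  collect : ∀ N g h B → + 2 * (N * (+ 2 * g)) + - + 1 * h + B ≡ + 4 * (N * g) - h + B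
  collect = solve-∀
  split : ∀ j → + 4 * t j ≡ + 2 * w j + - + 1 * b j + c j
  split j = begin
    + 4 * (K * Q * + (2 ^ j) * G j)       ≡⟨ cong (λ p → + 4 * (K * Q * p * G j)) (pos-^ 2 j) ⟩
    + 4 * (K * Q * P * G j)               ≡⟨ pull K Q P (G j) ⟩
    K * (+ 4 * Q) * P * G j               ≡⟨ cong (λ q → K * q * P * G j) (4*⌊j/2⌋≡2j-1+[-1]^j j) ⟩
    K * (+ 2 * + j - + 1 + sgn j) * P * G j
      ≡⟨ expand K (+ j) (sgn j) P (G j) ⟩
    + 2 * w j + - + 1 * b j + K * (sgn j * P * G j)
      ≡⟨ cong (λ r → + 2 * w j + - + 1 * b j + K * (r * G j)) ([-2]^j≡[-1]^j*2^j j) ⟨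
    + 2 * w j + - + 1 * b j + c j         ∎
    where
    K Q P : ℤ
    K = + (n C j)
    Q = + (j / 2)
    P = (+ 2) ℤ.^ j

n%2≡0⇒n≡[n/2]*2 : ∀ n → n % 2 ≡ 0 → n ≡ n / 2 ℕ.* 2
n%2≡0⇒n≡[n/2]*2 n even = trans (m≡m%n+[m/n]*n n 2) (cong (ℕ._+ n / 2 ℕ.* 2) even)

n%2≡1⇒n≡1+[n/2]*2 : ∀ n → n % 2 ≡ 1 → n ≡ suc (n / 2 ℕ.* 2)
n%2≡1⇒n≡1+[n/2]*2 n odd = trans (m≡m%n+[m/n]*n n 2) (cong (ℕ._+ n / 2 ℕ.* 2) odd)

n%2≡1⇒[n∸1]/2≡n/2 : ∀ n → n % 2 ≡ 1 → (n ℕ.∸ 1) / 2 ≡ n / 2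
n%2≡1⇒[n∸1]/2≡n/2 n odd = trans (cong (λ i → (i ℕ.∸ 1) / 2) (n%2≡1⇒n≡1+[n/2]*2 n odd)) (m*n/n≡m (n / 2) 2)

n%2≡1⇒[n+1]/2≡1+n/2 : ∀ n → n % 2 ≡ 1 → (n ℕ.+ 1) / 2 ≡ suc (n / 2)
n%2≡1⇒[n+1]/2≡1+n/2 n odd = begin
  (n ℕ.+ 1) / 2                    ≡⟨ cong (λ i → (i ℕ.+ 1) / 2) (n%2≡1⇒n≡1+[n/2]*2 n odd) ⟩
  (suc (n / 2 ℕ.* 2) ℕ.+ 1) / 2    ≡⟨ cong (_/ 2) (ℕₚ.+-comm (suc (n / 2 ℕ.* 2)) 1) ⟩
  suc (n / 2) ℕ.* 2 / 2            ≡⟨ m*n/n≡m (suc (n / 2)) 2 ⟩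
  suc (n / 2)                      ∎

⟨1-2E⟩^-even : ∀ n G → IsFibonacciLike G → n % 2 ≡ 0 → ⟨1+ - + 2 E⟩^[ n ] G 0 ≡ + (5 ^ (n / 2)) * G 0
⟨1-2E⟩^-even n G fibG even =
  trans (cong (λ i → ⟨1+ - + 2 E⟩^[ i ] G 0) (n%2≡0⇒n≡[n/2]*2 n even))
        (⟨1-2E⟩^[2h]-fibonacciLike (n / 2) G fibG 0)

⟨1-2E⟩^-odd : ∀ n G → IsFibonacciLike G → n % 2 ≡ 1 →
  ⟨1+ - + 2 E⟩^[ n ] G 0 ≡ - (+ (5 ^ (n / 2)) * (+ 2 * G 1 - G 0))
⟨1-2E⟩^-odd n G fibG odd =
  trans (cong (λ i → ⟨1+ - + 2 E⟩^[ i ] G 0) (n%2≡1⇒n≡1+[n/2]*2 n odd))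
        (trans (⟨1-2E⟩^[2h]-fibonacciLike (n / 2) (⟨1+ - + 2 E⟩ G) (⟨1+E⟩-fibonacciLike (- + 2) G fibG) 0)
               (negate (+ (5 ^ (n / 2))) (G 0) (G 1)))
  where
  negate : ∀ p a b → p * (a + - + 2 * b) ≡ - (p * (+ 2 * b - a))
  negate = solve-∀

module _ {A : ℤ → ℤ} (recA : FibonacciRecurrence A) (m : ℤ) where

  private
    G : ℕ → ℤ
    G j = A (+ j + m)

  4*binomialFloorSum-recurrence : ∀ n → 1 ℕ.≤ n →
    + 4 * binomialFloorSum n G
      ≡ + 4 * (+ n * A (+ (3 ℕ.* n) + m - + 2)) - A (+ (3 ℕ.* n) + m) + ⟨1+ - + 2 E⟩^[ n ] G 0
  4*binomialFloorSum-recurrence (suc k) _ =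
    trans (4*binomialFloorSum-fibonacciLike k G (recurrence⇒fibonacciLike recA m))
          (cong₂ (λ i i′ → + 4 * (+ suc k * A i) - A i′ + ⟨1+ - + 2 E⟩^[ suc k ] G 0)
                 index₁ (cong (λ i → + i + m) (ℕₚ.*-comm (suc k) 3)))
    where
    3[1+k]≡2+[1+3k] : ∀ k → 3 ℕ.* suc k ≡ 2 ℕ.+ suc (k ℕ.* 3)
    3[1+k]≡2+[1+3k] = ℕ-Solver.solve-∀
    cancel : ∀ i m → + 2 + i + m - + 2 ≡ i + m
    cancel = solve-∀
    index₁ : + suc (k ℕ.* 3) + m ≡ + (3 ℕ.* suc k) + m - + 2
    index₁ = sym (trans (cong (λ i → + i + m - + 2) (3[1+k]≡2+[1+3k] k)) (cancel (+ suc (k ℕ.* 3)) m))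

  binomialFloorSum-even : ∀ n → 1 ℕ.≤ n → n % 2 ≡ 0 →
    + 4 * binomialFloorSum n G
      ≡ + 4 * (+ n * A (+ (3 ℕ.* n) + m - + 2)) - A (+ (3 ℕ.* n) + m) + + (5 ^ (n / 2)) * A m
  binomialFloorSum-even n 1≤n even =
    trans (4*binomialFloorSum-recurrence n 1≤n)
          (cong (_+_ (+ 4 * (+ n * A (+ (3 ℕ.* n) + m - + 2)) - A (+ (3 ℕ.* n) + m)))
                (trans (⟨1-2E⟩^-even n G (recurrence⇒fibonacciLike recA m) even)
                       (cong (λ i → + (5 ^ (n / 2)) * A i) (+-identityˡ m))))

  binomialFloorSum-odd : ∀ n → 1 ℕ.≤ n → n % 2 ≡ 1 →
    + 4 * binomialFloorSum n G
      ≡ + 4 * (+ n * A (+ (3 ℕ.* n) + m - + 2)) - A (+ (3 ℕ.* n) + m)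
        - + (5 ^ (n / 2)) * (+ 2 * A (+ 1 + m) - A m)
  binomialFloorSum-odd n 1≤n odd =
    trans (4*binomialFloorSum-recurrence n 1≤n)
          (cong (_+_ (+ 4 * (+ n * A (+ (3 ℕ.* n) + m - + 2)) - A (+ (3 ℕ.* n) + m)))
                (trans (⟨1-2E⟩^-odd n G (recurrence⇒fibonacciLike recA m) odd)
                       (cong (λ i → - (+ (5 ^ (n / 2)) * (+ 2 * A (+ 1 + m) - A i))) (+-identityˡ m))))

5^h*[5z]≡5^[1+h]*z : ∀ h z → + (5 ^ h) * (+ 5 * z) ≡ + (5 ^ suc h) * z
5^h*[5z]≡5^[1+h]*z h z = trans (swap (+ (5 ^ h)) z) (cong (_* z) (sym (pos-* 5 (5 ^ h))))
  where
  swap : ∀ p z → p * (+ 5 * z) ≡ + 5 * p * z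
  swap = solve-∀

theorem19 : (m : ℤ) (n : ℕ) → 1 ℕ.≤ n →
    ((n ℕ.% 2 ≡ 0 →
        + 4 * sum1to n (λ j → + (n C j) * + (j / 2) * + (2 ^ j) * F (+ j + m))
          ≡ + 4 * (+ n * F (+ (3 ℕ.* n) + m - + 2)) - F (+ (3 ℕ.* n) + m) + + (5 ^ (n / 2)) * F m)
     × (n ℕ.% 2 ≡ 1 →
        + 4 * sum1to n (λ j → + (n C j) * + (j / 2) * + (2 ^ j) * F (+ j + m))
          ≡ + 4 * (+ n * F (+ (3 ℕ.* n) + m - + 2)) - F (+ (3 ℕ.* n) + m) - + (5 ^ ((n ℕ.∸ 1) / 2)) * L m))
    × ((n ℕ.% 2 ≡ 0 →
        + 4 * sum1to n (λ j → + (n C j) * + (j / 2) * + (2 ^ j) * L (+ j + m))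
          ≡ + 4 * (+ n * L (+ (3 ℕ.* n) + m - + 2)) - L (+ (3 ℕ.* n) + m) + + (5 ^ (n / 2)) * L m)
     × (n ℕ.% 2 ≡ 1 →
        + 4 * sum1to n (λ j → + (n C j) * + (j / 2) * + (2 ^ j) * L (+ j + m))
          ≡ + 4 * (+ n * L (+ (3 ℕ.* n) + m - + 2)) - L (+ (3 ℕ.* n) + m) - + (5 ^ ((n ℕ.+ 1) / 2)) * F m))
theorem19 m n 1≤n =
    ( binomialFloorSum-even F-recurrence m n 1≤n
    , λ odd → trans (binomialFloorSum-odd F-recurrence m n 1≤n odd)
        (cong₂ (λ e l → leading F - + (5 ^ e) * l) (sym (n%2≡1⇒[n∸1]/2≡n/2 n odd)) (sym (L≡2F[1+k]-F m))))
  , ( binomialFloorSum-even L-recurrence m n 1≤n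
    , λ odd → trans (binomialFloorSum-odd L-recurrence m n 1≤n odd) (cong (_-_ (leading L)) (odd-L-term odd)))
  where
  leading : (ℤ → ℤ) → ℤ
  leading A = + 4 * (+ n * A (+ (3 ℕ.* n) + m - + 2)) - A (+ (3 ℕ.* n) + m)
  odd-L-term : n % 2 ≡ 1 → + (5 ^ (n / 2)) * (+ 2 * L (+ 1 + m) - L m) ≡ + (5 ^ ((n ℕ.+ 1) / 2)) * F m
  odd-L-term odd = begin
    + (5 ^ (n / 2)) * (+ 2 * L (+ 1 + m) - L m)  ≡⟨ cong (+ (5 ^ (n / 2)) *_) (5F≡2L[1+k]-L m) ⟨
    + (5 ^ (n / 2)) * (+ 5 * F m)                 ≡⟨ 5^h*[5z]≡5^[1+h]*z (n / 2) (F m) ⟩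
    + (5 ^ suc (n / 2)) * F m                     ≡⟨ cong (λ e → + (5 ^ e) * F m) (n%2≡1⇒[n+1]/2≡1+n/2 n odd) ⟨
    + (5 ^ ((n ℕ.+ 1) / 2)) * F m                 ∎
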